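{- Let $\mathfrak a_{n,m}$ be the number of $\sigma\in\mathcal{I}_n(110,120)$ with $\max(\sigma)=m$. Let $\mathfrak b_{n,k}=\sum_{\ell=0}^{n}|\mathcal W_{\ell,k}(110,120)|$ be the number of words of length at most $n$ over $\{0,\dots,k-1\}$ avoiding both $110$ and $120$. Then for all integers $0<m<n$, $$\mathfrak a_{n,m}=\sum_{p=m+1}^{n}\sum_{j=0}^{m-1}\mathfrak a_{p-1,j}\,\mathfrak b_{n-p,m-j}.$$
   Context: For $n\in\mathbb N$, an inversion sequence of size $n$ is a sequence $\sigma=(\sigma_1,\dots,\sigma_n)\in\mathbb N^n$ with $\sigma_i<i$ for all $i$. An integer sequence contains a pattern $\rho$ (a finite integer sequence such as $110$ or $120$) if it has a subsequence order-isomorphic to $\rho$, and avoids $\rho$ otherwise. $\mathcal{I}_n(P)$ denotes the set of inversion sequences of size $n$ avoiding every pattern in the set $P$. $\mathcal W_{n,k}=\{0,\dots,k-1\}^n$ is the set of words of length $n$ over $\{0,\dots,k-1\}$, and $\mathcal W_{n,k}(P)$ its subset of words avoiding every pattern in $P$. $\max(\sigma)$ is the largest entry of $\sigma$. -}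

module Defs where

open import Data.Bool using (Bool; true; false; _∧_; not)
open import Data.Nat using (ℕ; zero; suc; _+_; _∸_; _<ᵇ_; _≡ᵇ_; _⊔_)
open import Data.List using (List; []; _∷_; _++_; [_]; map; concatMap; upTo; filterᵇ; length; foldr)
open import Data.Bool.ListAction using (any)
open import Data.Nat.ListAction using (sum)

_==_ : Bool → Bool → Bool
true  == b = b
false == b = not b

subseqs : {A : Set} → List A → List (List A)
subseqs []       = [] ∷ []
subseqs (x ∷ xs) = map (x ∷_) (subseqs xs) ++ subseqs xs

sameCmp : ℕ → ℕ → ℕ → ℕ → Bool
sameCmp x y u v = ((x <ᵇ y) == (u <ᵇ v)) ∧ ((y <ᵇ x) == (v <ᵇ u))

headCmp : ℕ → List ℕ → ℕ → List ℕ → Bool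
headCmp x []       u []       = true
headCmp x (y ∷ ys) u (v ∷ vs) = sameCmp x y u v ∧ headCmp x ys u vs
headCmp x _        u _        = false

orderIso : List ℕ → List ℕ → Bool
orderIso []       []       = true
orderIso (x ∷ xs) (u ∷ us) = headCmp x xs u us ∧ orderIso xs us
orderIso _        _        = false

contains : List ℕ → List ℕ → Bool
contains ρ σ = any (λ τ → orderIso τ ρ) (subseqs σ)

avoids110-120 : List ℕ → Bool
avoids110-120 σ = not (contains (1 ∷ 1 ∷ 0 ∷ []) σ) ∧ not (contains (1 ∷ 2 ∷ 0 ∷ []) σ)

-- All inversion sequences of size n: (σ₁,…,σₙ) with 0 ≤ σᵢ < i (1-indexed).
invSeqs : ℕ → List (List ℕ)
invSeqs zero    = [] ∷ []
invSeqs (suc n) = concatMap (λ s → map (λ x → s ++ [ x ]) (upTo (suc n))) (invSeqs n)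

words : ℕ → ℕ → List (List ℕ)
words zero    k = [] ∷ []
words (suc ℓ) k = concatMap (λ x → map (x ∷_) (words ℓ k)) (upTo k)

-- max(σ) (largest entry; 0 for the empty sequence).
maxL : List ℕ → ℕ
maxL = foldr _⊔_ 0

𝔞 : ℕ → ℕ → ℕ
𝔞 n m = length (filterᵇ (λ σ → maxL σ ≡ᵇ m) (filterᵇ avoids110-120 (invSeqs n)))

-- Σ_{i=a}^{b} f i  (empty if b < a).
Σ[_⋯_] : ℕ → ℕ → (ℕ → ℕ) → ℕ
Σ[ a ⋯ b ] f = sum (map (λ i → f (a + i)) (upTo (suc b ∸ a)))

𝔟 : ℕ → ℕ → ℕ
𝔟 n k = Σ[ 0 ⋯ n ] (λ ℓ → length (filterᵇ avoids110-120 (words ℓ k)))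

-- Cut σ ∈ 𝓘ₙ(110,120) with max σ = m > 0 at its first m: σ = s · m · w, where s has length p − 1 ≥ m,
-- entries < m and maximum j < m.  An occurrence of 110 or 120 is a triple σₖ < σᵢ ≤ σⱼ (i < j < k),
-- so σ avoids both patterns iff s does, no entry of w is below j, and m · w does; the last condition
-- says that w is a word over [j, m) avoiding the patterns followed by a run of m's.  As p > m, the
-- inversion-sequence bounds on w are void, so there are 𝔟_{n−p, m−j} choices of w for each of the
-- 𝔞_{p−1, j} choices of s.

module Submission where

open import Defs
open import Data.Bool using (T; Bool; true; false; _∧_; _∨_; not; if_then_else_)
open import Data.Bool.Properties
  using (∨-assoc; ∨-idem; ∨-identityʳ; ∨-zeroʳ; ∧-identityʳ; ∧-zeroʳ; ∧-distribˡ-∨;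
         ∨-idempotentCommutativeMonoid; ∨-∧-booleanAlgebra)
open import Data.Bool.ListAction using (any; all)
open import Data.Nat using (ℕ; zero; suc; _+_; _*_; _∸_; _<ᵇ_; _≡ᵇ_; _⊔_; _<_; _≤_; z≤n; s≤s)
open import Data.Nat.Properties
open import Data.List using (List; []; _∷_; _++_; [_]; map; concatMap; upTo; applyUpTo; filterᵇ; length)
open import Data.Nat.ListAction using (sum)
open import Function using (_∘_; id)
open import Data.Empty using (⊥-elim)
open import Relation.Nullary using (¬_)
open import Relation.Binary.Definitions using (tri<; tri≈; tri>)
open import Data.List.Relation.Unary.All using (All; []; _∷_)
import Data.List.Relation.Unary.All as All
open import Data.List.Relation.Unary.All.Properties using (++⁺)
open import Data.List.Properties using (++-assoc; ++-identityʳ)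
open import Relation.Binary.PropositionalEquality hiding ([_])
open import Algebra.Properties.CommutativeSemigroup +-commutativeSemigroup
  using () renaming (interchange to +-interchange)
open import Algebra.Lattice.Properties.BooleanAlgebra ∨-∧-booleanAlgebra using (deMorgan₂)
open import Algebra.Solver.IdempotentCommutativeMonoid ∨-idempotentCommutativeMonoid
  using (solve; _⊜_; _⊕_)

𝟙 : Bool → ℕ
𝟙 true  = 1
𝟙 false = 0

∑ : {A : Set} → List A → (A → ℕ) → ℕ
∑ xs f = sum (map f xs)

∑< : ℕ → (ℕ → ℕ) → ℕ
∑< zero    f = 0
∑< (suc n) f = f 0 + ∑< n (f ∘ suc)

module _ {A : Set} where

  ∑-cong : {f g : A → ℕ} → (∀ x → f x ≡ g x) → ∀ xs → ∑ xs f ≡ ∑ xs g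
  ∑-cong f≗g []       = refl
  ∑-cong f≗g (x ∷ xs) = cong₂ _+_ (f≗g x) (∑-cong f≗g xs)

  ∑-≡0 : {f : A → ℕ} → (∀ x → f x ≡ 0) → ∀ xs → ∑ xs f ≡ 0
  ∑-≡0 f≗0 []       = refl
  ∑-≡0 f≗0 (x ∷ xs) = cong₂ _+_ (f≗0 x) (∑-≡0 f≗0 xs)

  ∑-++ : ∀ xs ys (f : A → ℕ) → ∑ (xs ++ ys) f ≡ ∑ xs f + ∑ ys f
  ∑-++ []       ys f = refl
  ∑-++ (x ∷ xs) ys f = trans (cong (f x +_) (∑-++ xs ys f)) (sym (+-assoc (f x) _ _))

  ∑-distrib-+ : ∀ xs (f g : A → ℕ) → ∑ xs (λ x → f x + g x) ≡ ∑ xs f + ∑ xs g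
  ∑-distrib-+ []       f g = refl
  ∑-distrib-+ (x ∷ xs) f g rewrite ∑-distrib-+ xs f g = +-interchange (f x) (g x) (∑ xs f) (∑ xs g)

  ∑-*ˡ : ∀ c xs (f : A → ℕ) → ∑ xs (λ x → c * f x) ≡ c * ∑ xs f
  ∑-*ˡ c []       f = sym (*-zeroʳ c)
  ∑-*ˡ c (x ∷ xs) f rewrite ∑-*ˡ c xs f = sym (*-distribˡ-+ c (f x) (∑ xs f))

  ∑-*ʳ : ∀ c xs (f : A → ℕ) → ∑ xs (λ x → f x * c) ≡ ∑ xs f * c
  ∑-*ʳ c xs f = begin
    ∑ xs (λ x → f x * c)  ≡⟨ ∑-cong (λ x → *-comm (f x) c) xs ⟩
    ∑ xs (λ x → c * f x)  ≡⟨ ∑-*ˡ c xs f ⟩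
    c * ∑ xs f            ≡⟨ *-comm c (∑ xs f) ⟩
    ∑ xs f * c            ∎
    where open ≡-Reasoning

  length-filterᵇ : ∀ (p : A → Bool) xs → length (filterᵇ p xs) ≡ ∑ xs (𝟙 ∘ p)
  length-filterᵇ p []       = refl
  length-filterᵇ p (x ∷ xs) with p x
  ... | true  = cong suc (length-filterᵇ p xs)
  ... | false = length-filterᵇ p xs

  length-filterᵇ-filterᵇ : ∀ (p q : A → Bool) xs →
    length (filterᵇ q (filterᵇ p xs)) ≡ ∑ xs (λ x → 𝟙 (p x ∧ q x))
  length-filterᵇ-filterᵇ p q []       = refl
  length-filterᵇ-filterᵇ p q (x ∷ xs) with p x
  ... | false = length-filterᵇ-filterᵇ p q xs
  ... | true with q x
  ...   | true  = cong suc (length-filterᵇ-filterᵇ p q xs)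
  ...   | false = length-filterᵇ-filterᵇ p q xs

module _ {A B : Set} where

  ∑-map : ∀ (g : A → B) xs (f : B → ℕ) → ∑ (map g xs) f ≡ ∑ xs (f ∘ g)
  ∑-map g []       f = refl
  ∑-map g (x ∷ xs) f = cong (f (g x) +_) (∑-map g xs f)

  ∑-concatMap : ∀ (g : A → List B) xs (f : B → ℕ) →
    ∑ (concatMap g xs) f ≡ ∑ xs (λ x → ∑ (g x) f)
  ∑-concatMap g []       f = refl
  ∑-concatMap g (x ∷ xs) f =
    trans (∑-++ (g x) _ f) (cong (∑ (g x) f +_) (∑-concatMap g xs f))

∑-upTo : ∀ n (f : ℕ → ℕ) → ∑ (upTo n) f ≡ ∑< n f
∑-upTo n f = go id n
  where
  go : ∀ (g : ℕ → ℕ) n → ∑ (applyUpTo g n) f ≡ ∑< n (f ∘ g)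
  go g zero    = refl
  go g (suc n) = cong (f (g 0) +_) (go (g ∘ suc) n)

∑<-cong< : ∀ n {f g : ℕ → ℕ} → (∀ i → i < n → f i ≡ g i) → ∑< n f ≡ ∑< n g
∑<-cong< zero    f≗g = refl
∑<-cong< (suc n) f≗g = cong₂ _+_ (f≗g 0 (s≤s z≤n)) (∑<-cong< n (λ i i<n → f≗g (suc i) (s≤s i<n)))

∑<-cong : ∀ n {f g : ℕ → ℕ} → (∀ i → f i ≡ g i) → ∑< n f ≡ ∑< n g
∑<-cong n f≗g = ∑<-cong< n (λ i _ → f≗g i)

∑<-≡0 : ∀ n {f : ℕ → ℕ} → (∀ i → i < n → f i ≡ 0) → ∑< n f ≡ 0
∑<-≡0 zero    f≗0 = refl
∑<-≡0 (suc n) f≗0 = cong₂ _+_ (f≗0 0 (s≤s z≤n)) (∑<-≡0 n (λ i i<n → f≗0 (suc i) (s≤s i<n)))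

∑<-distrib-+ : ∀ n (f g : ℕ → ℕ) → ∑< n (λ i → f i + g i) ≡ ∑< n f + ∑< n g
∑<-distrib-+ zero    f g = refl
∑<-distrib-+ (suc n) f g rewrite ∑<-distrib-+ n (f ∘ suc) (g ∘ suc) =
  +-interchange (f 0) (g 0) (∑< n (f ∘ suc)) (∑< n (g ∘ suc))

∑<-*ˡ : ∀ c n (f : ℕ → ℕ) → ∑< n (λ i → c * f i) ≡ c * ∑< n f
∑<-*ˡ c zero    f = sym (*-zeroʳ c)
∑<-*ˡ c (suc n) f rewrite ∑<-*ˡ c n (f ∘ suc) = sym (*-distribˡ-+ c (f 0) _)

∑<-+ : ∀ a b (f : ℕ → ℕ) → ∑< (a + b) f ≡ ∑< a f + ∑< b (λ i → f (a + i))
∑<-+ zero    b f = refl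
∑<-+ (suc a) b f = trans (cong (f 0 +_) (∑<-+ a b (f ∘ suc))) (sym (+-assoc (f 0) _ _))

∑<-suc : ∀ n (f : ℕ → ℕ) → ∑< (suc n) f ≡ ∑< n f + f n
∑<-suc n f = begin
  ∑< (suc n) f                 ≡⟨ cong (λ k → ∑< k f) (+-comm 1 n) ⟩
  ∑< (n + 1) f                 ≡⟨ ∑<-+ n 1 f ⟩
  ∑< n f + (f (n + 0) + 0)     ≡⟨ cong (∑< n f +_) (trans (+-identityʳ _) (cong f (+-identityʳ n))) ⟩
  ∑< n f + f n                 ∎
  where open ≡-Reasoning

∑<-comm : ∀ a b (f : ℕ → ℕ → ℕ) → ∑< a (λ i → ∑< b (f i)) ≡ ∑< b (λ j → ∑< a (λ i → f i j))
∑<-comm zero    b f = sym (∑<-≡0 b (λ _ _ → refl))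
∑<-comm (suc a) b f rewrite ∑<-comm a b (f ∘ suc) =
  sym (∑<-distrib-+ b (f 0) (λ j → ∑< a (λ i → f (suc i) j)))

∑<-∑ : {A : Set} → ∀ n xs (f : ℕ → A → ℕ) →
  ∑< n (λ i → ∑ xs (f i)) ≡ ∑ xs (λ x → ∑< n (λ i → f i x))
∑<-∑ zero    xs f = sym (∑-≡0 (λ _ → refl) xs)
∑<-∑ (suc n) xs f rewrite ∑<-∑ n xs (f ∘ suc) =
  sym (∑-distrib-+ xs (f 0) (λ x → ∑< n (λ i → f (suc i) x)))

∑<-indicator : ∀ N m (h : ℕ → ℕ) →
  ∑< N (λ i → if i ≡ᵇ m then h i else 0) ≡ (if m <ᵇ N then h m else 0)
∑<-indicator zero    m       h = refl
∑<-indicator (suc N) zero    h = trans (cong (h 0 +_) (∑<-≡0 N (λ _ _ → refl))) (+-identityʳ _)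
∑<-indicator (suc N) (suc m) h = ∑<-indicator N m (h ∘ suc)

<⇒<ᵇ≡true : ∀ {x y} → x < y → (x <ᵇ y) ≡ true
<⇒<ᵇ≡true {zero}  {suc y} _         = refl
<⇒<ᵇ≡true {suc x} {suc y} (s≤s x<y) = <⇒<ᵇ≡true x<y

≤⇒>ᵇ≡false : ∀ {x y} → x ≤ y → (y <ᵇ x) ≡ false
≤⇒>ᵇ≡false {zero}            _         = refl
≤⇒>ᵇ≡false {suc x} {suc y} (s≤s x≤y) = ≤⇒>ᵇ≡false x≤y

<ᵇ≡true⇒< : ∀ {x y} → (x <ᵇ y) ≡ true → x < y
<ᵇ≡true⇒< {x} {y} x<ᵇy = <ᵇ⇒< x y (subst T (sym x<ᵇy) _)

<ᵇ-irrefl : ∀ x → (x <ᵇ x) ≡ false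
<ᵇ-irrefl x = ≤⇒>ᵇ≡false (≤-refl {x})

≡ᵇ-refl : ∀ x → (x ≡ᵇ x) ≡ true
≡ᵇ-refl zero    = refl
≡ᵇ-refl (suc x) = ≡ᵇ-refl x

≡ᵇ-sym : ∀ x y → (x ≡ᵇ y) ≡ (y ≡ᵇ x)
≡ᵇ-sym zero    zero    = refl
≡ᵇ-sym zero    (suc y) = refl
≡ᵇ-sym (suc x) zero    = refl
≡ᵇ-sym (suc x) (suc y) = ≡ᵇ-sym x y

≡ᵇ≡true⇒≡ : ∀ {x y} → (x ≡ᵇ y) ≡ true → x ≡ y
≡ᵇ≡true⇒≡ {x} {y} x≡ᵇy = ≡ᵇ⇒≡ x y (subst T (sym x≡ᵇy) _)

≡ᵇ≡false⇒≢ : ∀ {x y} → (x ≡ᵇ y) ≡ false → x ≢ y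
≡ᵇ≡false⇒≢ {x} x≢ᵇy refl with trans (sym x≢ᵇy) (≡ᵇ-refl x)
... | ()

<⇒≡ᵇ≡false : ∀ {x y} → x < y → (x ≡ᵇ y) ≡ false
<⇒≡ᵇ≡false {zero}  {suc y} _         = refl
<⇒≡ᵇ≡false {suc x} {suc y} (s≤s x<y) = <⇒≡ᵇ≡false x<y

<ᵇ-⊔ : ∀ z x y → (z <ᵇ x ⊔ y) ≡ (z <ᵇ x) ∨ (z <ᵇ y)
<ᵇ-⊔ z       zero    y       = refl
<ᵇ-⊔ zero    (suc x) zero    = refl
<ᵇ-⊔ zero    (suc x) (suc y) = refl
<ᵇ-⊔ (suc z) (suc x) zero    = sym (∨-identityʳ _)
<ᵇ-⊔ (suc z) (suc x) (suc y) = <ᵇ-⊔ z x y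

⊔-<ᵇ : ∀ x y z → (x ⊔ y <ᵇ z) ≡ (x <ᵇ z) ∧ (y <ᵇ z)
⊔-<ᵇ zero    zero    zero    = refl
⊔-<ᵇ zero    zero    (suc z) = refl
⊔-<ᵇ zero    (suc y) zero    = refl
⊔-<ᵇ zero    (suc y) (suc z) = refl
⊔-<ᵇ (suc x) zero    zero    = refl
⊔-<ᵇ (suc x) zero    (suc z) = sym (∧-identityʳ _)
⊔-<ᵇ (suc x) (suc y) zero    = refl
⊔-<ᵇ (suc x) (suc y) (suc z) = ⊔-<ᵇ x y z

+-<ᵇ-+ˡ : ∀ j x y → (j + x <ᵇ j + y) ≡ (x <ᵇ y)
+-<ᵇ-+ˡ zero    x y = refl
+-<ᵇ-+ˡ (suc j) x y = +-<ᵇ-+ˡ j x y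

∨-interchange : ∀ a b c d → (a ∨ b) ∨ (c ∨ d) ≡ (a ∨ c) ∨ (b ∨ d)
∨-interchange = solve 4 (λ a b c d → (a ⊕ b) ⊕ (c ⊕ d) ⊜ (a ⊕ c) ⊕ (b ⊕ d)) refl

maxL-≤ : ∀ {m} s → All (_≤ m) s → maxL s ≤ m
maxL-≤ []      []         = z≤n
maxL-≤ (x ∷ s) (x≤m ∷ s≤m) = ⊔-lub x≤m (maxL-≤ s s≤m)

maxL-++ : ∀ xs ys → maxL (xs ++ ys) ≡ maxL xs ⊔ maxL ys
maxL-++ []       ys = refl
maxL-++ (x ∷ xs) ys rewrite maxL-++ xs ys = sym (⊔-assoc x (maxL xs) (maxL ys))

maxL-< : ∀ {m} s → 0 < m → All (_< m) s → maxL s < m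
maxL-< []      0<m []          = 0<m
maxL-< (x ∷ s) 0<m (x<m ∷ s<m) = ⊔-lub x<m (maxL-< s 0<m s<m)

maxL-≤⇒All : ∀ {m} t → maxL t ≤ m → All (_≤ m) t
maxL-≤⇒All []      _       = []
maxL-≤⇒All (x ∷ t) max≤m =
  ≤-trans (m≤m⊔n x (maxL t)) max≤m ∷ maxL-≤⇒All t (≤-trans (m≤n⊔m x (maxL t)) max≤m)

⊔-maxL-≤ : ∀ s x t → x ⊔ maxL t ≤ maxL (s ++ x ∷ t)
⊔-maxL-≤ s x t = subst (x ⊔ maxL t ≤_) (sym (maxL-++ s (x ∷ t))) (m≤n⊔m (maxL s) (x ⊔ maxL t))

all-<ᵇ≡maxL-<ᵇ : ∀ m t → all (_<ᵇ suc m) t ≡ (maxL t <ᵇ suc m)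
all-<ᵇ≡maxL-<ᵇ m []      = refl
all-<ᵇ≡maxL-<ᵇ m (x ∷ t) rewrite ⊔-<ᵇ x (maxL t) (suc m) | all-<ᵇ≡maxL-<ᵇ m t = refl

-- Occurrences of 110 and 120

-- An occurrence of 110 or 120 is a triple of positions i < j < k with σₖ < σᵢ ≤ σⱼ.
startsOccurrence : ℕ → List ℕ → Bool
startsOccurrence x []       = false
startsOccurrence x (y ∷ ys) = (not (y <ᵇ x) ∧ any (_<ᵇ x) ys) ∨ startsOccurrence x ys

hasOccurrence : List ℕ → Bool
hasOccurrence []       = false
hasOccurrence (x ∷ xs) = startsOccurrence x xs ∨ hasOccurrence xs

is110or120 : List ℕ → Bool
is110or120 τ = orderIso τ (1 ∷ 1 ∷ 0 ∷ []) ∨ orderIso τ (1 ∷ 2 ∷ 0 ∷ [])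

anySubseq : (List ℕ → Bool) → List ℕ → Bool
anySubseq f xs = any f (subseqs xs)

headCmp-length : ∀ x xs u us → length xs ≢ length us → headCmp x xs u us ≡ false
headCmp-length x []       u []       len≢ = ⊥-elim (len≢ refl)
headCmp-length x []       u (v ∷ vs) len≢ = refl
headCmp-length x (y ∷ ys) u []       len≢ = refl
headCmp-length x (y ∷ ys) u (v ∷ vs) len≢
  rewrite headCmp-length x ys u vs (len≢ ∘ cong suc) = ∧-zeroʳ (sameCmp x y u v)

orderIso-length : ∀ xs us → length xs ≢ length us → orderIso xs us ≡ false
orderIso-length []       []       len≢ = ⊥-elim (len≢ refl)
orderIso-length []       (u ∷ us) len≢ = refl
orderIso-length (x ∷ xs) []       len≢ = refl
orderIso-length (x ∷ xs) (u ∷ us) len≢ rewrite headCmp-length x xs u us (len≢ ∘ cong suc) = refl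

is110or120-length : ∀ τ → length τ ≢ 3 → is110or120 τ ≡ false
is110or120-length τ len≢ rewrite orderIso-length τ (1 ∷ 1 ∷ 0 ∷ []) len≢
                           | orderIso-length τ (1 ∷ 2 ∷ 0 ∷ []) len≢ = refl

is110or120-triple : ∀ a b c → is110or120 (a ∷ b ∷ c ∷ []) ≡ not (b <ᵇ a) ∧ (c <ᵇ a)
is110or120-triple zero    zero    zero    = refl
is110or120-triple zero    zero    (suc c) = refl
is110or120-triple zero    (suc b) zero    = refl
is110or120-triple zero    (suc b) (suc c) = refl
is110or120-triple (suc a) zero    zero    = refl
is110or120-triple (suc a) zero    (suc c) = refl
is110or120-triple (suc a) (suc b) zero with a <ᵇ b | b <ᵇ a
... | true  | true  = refl
... | true  | false = refl
... | false | true  = refl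
... | false | false = refl
is110or120-triple (suc a) (suc b) (suc c) = is110or120-triple a b c

module _ {A : Set} where

  any-++ : ∀ (f : A → Bool) xs ys → any f (xs ++ ys) ≡ any f xs ∨ any f ys
  any-++ f []       ys = refl
  any-++ f (x ∷ xs) ys = trans (cong (f x ∨_) (any-++ f xs ys)) (sym (∨-assoc (f x) _ _))

  any-map : ∀ {B : Set} (f : B → Bool) (g : A → B) xs → any f (map g xs) ≡ any (f ∘ g) xs
  any-map f g []       = refl
  any-map f g (x ∷ xs) = cong (f (g x) ∨_) (any-map f g xs)

  any-≡false : ∀ {f : A → Bool} → (∀ x → f x ≡ false) → ∀ xs → any f xs ≡ false
  any-≡false f≗false []       = refl
  any-≡false f≗false (x ∷ xs) rewrite f≗false x = any-≡false f≗false xs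

  any-∨ : ∀ (f g : A → Bool) xs → any (λ x → f x ∨ g x) xs ≡ any f xs ∨ any g xs
  any-∨ f g []       = refl
  any-∨ f g (x ∷ xs) rewrite any-∨ f g xs = ∨-interchange (f x) (g x) (any f xs) (any g xs)

anySubseq-∷ : ∀ f x xs → anySubseq f (x ∷ xs) ≡ anySubseq (f ∘ (x ∷_)) xs ∨ anySubseq f xs
anySubseq-∷ f x xs = trans (any-++ f (map (x ∷_) (subseqs xs)) (subseqs xs))
                           (cong (_∨ anySubseq f xs) (any-map f (x ∷_) (subseqs xs)))

anySubseq-[] : ∀ f → (∀ a τ → f (a ∷ τ) ≡ false) → ∀ xs → anySubseq f xs ≡ f []
anySubseq-[] f f∷≡false []       = ∨-identityʳ (f [])
anySubseq-[] f f∷≡false (x ∷ xs)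
  rewrite anySubseq-∷ f x xs | any-≡false (f∷≡false x) (subseqs xs) = anySubseq-[] f f∷≡false xs

anySubseq-is110or120-∷∷ : ∀ x y zs →
  anySubseq (λ τ → is110or120 (x ∷ y ∷ τ)) zs ≡ not (y <ᵇ x) ∧ any (_<ᵇ x) zs
anySubseq-is110or120-∷∷ x y []       =
  trans (cong (_∨ false) (is110or120-length (x ∷ y ∷ []) λ ())) (sym (∧-zeroʳ _))
anySubseq-is110or120-∷∷ x y (z ∷ zs)
  rewrite anySubseq-∷ (λ τ → is110or120 (x ∷ y ∷ τ)) z zs
        | anySubseq-[] (λ τ → is110or120 (x ∷ y ∷ z ∷ τ))
                       (λ a τ → is110or120-length (x ∷ y ∷ z ∷ a ∷ τ) λ ()) zs
        | is110or120-triple x y z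
        | anySubseq-is110or120-∷∷ x y zs = sym (∧-distribˡ-∨ (not (y <ᵇ x)) (z <ᵇ x) _)

anySubseq-is110or120-∷ : ∀ x ys → anySubseq (λ τ → is110or120 (x ∷ τ)) ys ≡ startsOccurrence x ys
anySubseq-is110or120-∷ x []       = refl
anySubseq-is110or120-∷ x (y ∷ ys)
  rewrite anySubseq-∷ (λ τ → is110or120 (x ∷ τ)) y ys
        | anySubseq-is110or120-∷∷ x y ys
        | anySubseq-is110or120-∷ x ys = refl

anySubseq-is110or120 : ∀ xs → anySubseq is110or120 xs ≡ hasOccurrence xs
anySubseq-is110or120 []       = refl
anySubseq-is110or120 (x ∷ xs)
  rewrite anySubseq-∷ is110or120 x xs
        | anySubseq-is110or120-∷ x xs
        | anySubseq-is110or120 xs = refl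

avoids110-120≡not-hasOccurrence : ∀ σ → avoids110-120 σ ≡ not (hasOccurrence σ)
avoids110-120≡not-hasOccurrence σ = begin
  not (contains (1 ∷ 1 ∷ 0 ∷ []) σ) ∧ not (contains (1 ∷ 2 ∷ 0 ∷ []) σ)
    ≡⟨ deMorgan₂ (contains (1 ∷ 1 ∷ 0 ∷ []) σ) (contains (1 ∷ 2 ∷ 0 ∷ []) σ) ⟨
  not (contains (1 ∷ 1 ∷ 0 ∷ []) σ ∨ contains (1 ∷ 2 ∷ 0 ∷ []) σ)
    ≡⟨ cong not (any-∨ (λ τ → orderIso τ (1 ∷ 1 ∷ 0 ∷ []))
                       (λ τ → orderIso τ (1 ∷ 2 ∷ 0 ∷ [])) (subseqs σ)) ⟨
  not (anySubseq is110or120 σ)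
    ≡⟨ cong not (anySubseq-is110or120 σ) ⟩
  not (hasOccurrence σ) ∎
  where open ≡-Reasoning

any-<ᵇ-⊔ : ∀ x y w → any (_<ᵇ x ⊔ y) w ≡ any (_<ᵇ x) w ∨ any (_<ᵇ y) w
any-<ᵇ-⊔ x y []       = refl
any-<ᵇ-⊔ x y (z ∷ zs) rewrite <ᵇ-⊔ z x y | any-<ᵇ-⊔ x y zs =
  ∨-interchange (z <ᵇ x) (z <ᵇ y) (any (_<ᵇ x) zs) (any (_<ᵇ y) zs)

any-<ᵇ-0 : ∀ w → any (_<ᵇ 0) w ≡ false
any-<ᵇ-0 = any-≡false (λ _ → refl)

any-<ᵇ-+ˡ : ∀ j x w → any (_<ᵇ j + x) (map (j +_) w) ≡ any (_<ᵇ x) w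
any-<ᵇ-+ˡ j x []       = refl
any-<ᵇ-+ˡ j x (z ∷ zs) rewrite +-<ᵇ-+ˡ j z x | any-<ᵇ-+ˡ j x zs = refl

startsOccurrence⇒any-<ᵇ : ∀ x w → any (_<ᵇ x) w ∨ startsOccurrence x w ≡ any (_<ᵇ x) w
startsOccurrence⇒any-<ᵇ x []       = refl
startsOccurrence⇒any-<ᵇ x (z ∷ zs) with z <ᵇ x
... | true  = refl
... | false = begin
  any (_<ᵇ x) zs ∨ (any (_<ᵇ x) zs ∨ startsOccurrence x zs)  ≡⟨ ∨-assoc (any (_<ᵇ x) zs) _ _ ⟨
  (any (_<ᵇ x) zs ∨ any (_<ᵇ x) zs) ∨ startsOccurrence x zs  ≡⟨ cong (_∨ startsOccurrence x zs) (∨-idem _) ⟩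
  any (_<ᵇ x) zs ∨ startsOccurrence x zs                    ≡⟨ startsOccurrence⇒any-<ᵇ x zs ⟩
  any (_<ᵇ x) zs                                            ∎
  where open ≡-Reasoning

startsOccurrence-++-∷ : ∀ {x m} s w → x ≤ m →
  startsOccurrence x (s ++ m ∷ w) ≡ startsOccurrence x s ∨ any (_<ᵇ x) w
startsOccurrence-++-∷ {x} {m} [] w x≤m rewrite ≤⇒>ᵇ≡false x≤m = startsOccurrence⇒any-<ᵇ x w
startsOccurrence-++-∷ {x} {m} (y ∷ s) w x≤m
  rewrite any-++ (_<ᵇ x) s (m ∷ w) | ≤⇒>ᵇ≡false x≤m | startsOccurrence-++-∷ s w x≤m
  with not (y <ᵇ x)
... | true  = solve 3 (λ a h l → (a ⊕ l) ⊕ (h ⊕ l) ⊜ (a ⊕ h) ⊕ l) refl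
                (any (_<ᵇ x) s) (startsOccurrence x s) (any (_<ᵇ x) w)
... | false = refl

-- An occurrence in s ++ m ∷ w lies in s, lies in m ∷ w, or straddles: then its last entry, in w,
-- is below an entry of s, and its middle entry can be taken to be m.
hasOccurrence-++-∷ : ∀ {m} s w → All (_≤ m) s →
  hasOccurrence (s ++ m ∷ w) ≡ hasOccurrence s ∨ (any (_<ᵇ maxL s) w ∨ hasOccurrence (m ∷ w))
hasOccurrence-++-∷ []      w []          rewrite any-<ᵇ-0 w = refl
hasOccurrence-++-∷ {m} (x ∷ s) w (x≤m ∷ s≤m)
  rewrite startsOccurrence-++-∷ s w x≤m | hasOccurrence-++-∷ s w s≤m | any-<ᵇ-⊔ x (maxL s) w =
  solve 5 (λ h l s′ m′ x′ → (h ⊕ l) ⊕ (s′ ⊕ (m′ ⊕ x′)) ⊜ (h ⊕ s′) ⊕ ((l ⊕ m′) ⊕ x′)) refl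
    (startsOccurrence x s) (any (_<ᵇ x) w) (hasOccurrence s) (any (_<ᵇ maxL s) w) (hasOccurrence (m ∷ w))

hasOccurrence-++ʳ : ∀ u v → hasOccurrence v ∨ hasOccurrence (u ++ v) ≡ hasOccurrence (u ++ v)
hasOccurrence-++ʳ []      v = ∨-idem (hasOccurrence v)
hasOccurrence-++ʳ (x ∷ u) v = begin
  hasOccurrence v ∨ (startsOccurrence x (u ++ v) ∨ hasOccurrence (u ++ v))
    ≡⟨ solve 3 (λ a b c → a ⊕ (b ⊕ c) ⊜ b ⊕ (a ⊕ c)) refl
               (hasOccurrence v) (startsOccurrence x (u ++ v)) (hasOccurrence (u ++ v)) ⟩
  startsOccurrence x (u ++ v) ∨ (hasOccurrence v ∨ hasOccurrence (u ++ v))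
    ≡⟨ cong (startsOccurrence x (u ++ v) ∨_) (hasOccurrence-++ʳ u v) ⟩
  startsOccurrence x (u ++ v) ∨ hasOccurrence (u ++ v) ∎
  where open ≡-Reasoning

startsOccurrence-+ˡ : ∀ j x w → startsOccurrence (j + x) (map (j +_) w) ≡ startsOccurrence x w
startsOccurrence-+ˡ j x []      = refl
startsOccurrence-+ˡ j x (y ∷ w)
  rewrite +-<ᵇ-+ˡ j y x | any-<ᵇ-+ˡ j x w | startsOccurrence-+ˡ j x w = refl

hasOccurrence-+ˡ : ∀ j w → hasOccurrence (map (j +_) w) ≡ hasOccurrence w
hasOccurrence-+ˡ j []      = refl
hasOccurrence-+ˡ j (x ∷ w) rewrite startsOccurrence-+ˡ j x w | hasOccurrence-+ˡ j w = refl

-- Cutting at the first maximum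

module _ {m : ℕ} where

  all-≡ᵇ⇒any-<ᵇ≡false : ∀ {y} w → y ≤ m → all (_≡ᵇ m) w ≡ true → any (_<ᵇ y) w ≡ false
  all-≡ᵇ⇒any-<ᵇ≡false []      y≤m _ = refl
  all-≡ᵇ⇒any-<ᵇ≡false (x ∷ w) y≤m w≡m with x ≡ᵇ m in x≡ᵇm
  ... | true rewrite ≡ᵇ≡true⇒≡ {x} {m} x≡ᵇm | ≤⇒>ᵇ≡false y≤m = all-≡ᵇ⇒any-<ᵇ≡false w y≤m w≡m

  all-≡ᵇ⇒startsOccurrence≡false : ∀ w → all (_≡ᵇ m) w ≡ true → startsOccurrence m w ≡ false
  all-≡ᵇ⇒startsOccurrence≡false []      _ = refl
  all-≡ᵇ⇒startsOccurrence≡false (x ∷ w) w≡m with x ≡ᵇ m in x≡ᵇm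
  ... | true rewrite ≡ᵇ≡true⇒≡ {x} {m} x≡ᵇm | all-≡ᵇ⇒any-<ᵇ≡false w ≤-refl w≡m
                   | all-≡ᵇ⇒startsOccurrence≡false w w≡m = cong (_∨ false) (∧-zeroʳ _)

  all-≡ᵇ⇒hasOccurrence≡false : ∀ w → all (_≡ᵇ m) w ≡ true → hasOccurrence w ≡ false
  all-≡ᵇ⇒hasOccurrence≡false []      _ = refl
  all-≡ᵇ⇒hasOccurrence≡false (x ∷ w) w≡m with x ≡ᵇ m in x≡ᵇm
  ... | true rewrite ≡ᵇ≡true⇒≡ {x} {m} x≡ᵇm | all-≡ᵇ⇒startsOccurrence≡false w w≡m
                   | all-≡ᵇ⇒hasOccurrence≡false w w≡m = refl

  all-≡ᵇ≡false⇒any-<ᵇ : ∀ w → All (_≤ m) w → all (_≡ᵇ m) w ≡ false → any (_<ᵇ m) w ≡ true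
  all-≡ᵇ≡false⇒any-<ᵇ (x ∷ w) (x≤m ∷ w≤m) w≢m with x ≡ᵇ m in x≡ᵇm
  ... | true  = trans (cong ((x <ᵇ m) ∨_) (all-≡ᵇ≡false⇒any-<ᵇ w w≤m w≢m)) (∨-zeroʳ _)
  ... | false = cong (_∨ any (_<ᵇ m) w) (<⇒<ᵇ≡true (≤∧≢⇒< x≤m (≡ᵇ≡false⇒≢ x≡ᵇm)))

-- tailForm j m P w holds iff w = v ++ m ∷ ⋯ ∷ m (with any number of copies of m, possibly none),
-- every entry of v lies in [j, m), and P v.
tailForm : ℕ → ℕ → (List ℕ → Bool) → List ℕ → Bool
tailForm j m P []      = P []
tailForm j m P (x ∷ w) =
  if x ≡ᵇ m then all (_≡ᵇ m) w ∧ P []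
  else (not (x <ᵇ j) ∧ (x <ᵇ m)) ∧ tailForm j m (λ v → P (x ∷ v)) w

tailForm-cong : ∀ j m {P Q} → (∀ v → P v ≡ Q v) → ∀ w → tailForm j m P w ≡ tailForm j m Q w
tailForm-cong j m P≗Q []      = P≗Q []
tailForm-cong j m P≗Q (x ∷ w) with x ≡ᵇ m
... | true  = cong (all (_≡ᵇ m) w ∧_) (P≗Q [])
... | false = cong ((not (x <ᵇ j) ∧ (x <ᵇ m)) ∧_) (tailForm-cong j m (λ v → P≗Q (x ∷ v)) w)

tailForm-avoids-++ : ∀ j m u w → j ≤ m → All (_≤ m) u → All (_≤ m) w →
  tailForm j m (λ v → not (hasOccurrence (u ++ v))) w
    ≡ not (any (_<ᵇ j) w) ∧ (not (hasOccurrence (m ∷ w)) ∧ not (hasOccurrence (u ++ w)))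
tailForm-avoids-++ j m u []      j≤m u≤m []          = refl
tailForm-avoids-++ j m u (x ∷ w) j≤m u≤m (x≤m ∷ w≤m) with x ≡ᵇ m in x≡ᵇm
... | true with refl ← ≡ᵇ≡true⇒≡ {x} {m} x≡ᵇm with all (_≡ᵇ x) w in w≡x
...   | true
  rewrite hasOccurrence-++-∷ u w u≤m | ≤⇒>ᵇ≡false j≤m | <ᵇ-irrefl x
        | all-≡ᵇ⇒any-<ᵇ≡false w j≤m w≡x | all-≡ᵇ⇒any-<ᵇ≡false w ≤-refl w≡x
        | all-≡ᵇ⇒any-<ᵇ≡false w (maxL-≤ u u≤m) w≡x
        | all-≡ᵇ⇒startsOccurrence≡false w w≡x | all-≡ᵇ⇒hasOccurrence≡false w w≡x
        | ++-identityʳ u | ∨-identityʳ (hasOccurrence u) = refl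
...   | false rewrite <ᵇ-irrefl x | all-≡ᵇ≡false⇒any-<ᵇ w w≤m w≡x =
  sym (∧-zeroʳ (not (any (_<ᵇ j) (x ∷ w))))
tailForm-avoids-++ j m u (x ∷ w) j≤m u≤m (x≤m ∷ w≤m) | false with x <ᵇ j
... | true  = refl
... | false rewrite <⇒<ᵇ≡true (≤∧≢⇒< x≤m (≡ᵇ≡false⇒≢ x≡ᵇm)) = begin
  tailForm j m (λ v → not (hasOccurrence (u ++ x ∷ v))) w
    ≡⟨ tailForm-cong j m (λ v → cong (not ∘ hasOccurrence) (++-assoc u [ x ] v)) w ⟨
  tailForm j m (λ v → not (hasOccurrence ((u ++ [ x ]) ++ v))) w
    ≡⟨ tailForm-avoids-++ j m (u ++ [ x ]) w j≤m (++⁺ u≤m (x≤m ∷ [])) w≤m ⟩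
  not (any (_<ᵇ j) w) ∧ (not (hasOccurrence (m ∷ w)) ∧ not (hasOccurrence ((u ++ [ x ]) ++ w)))
    ≡⟨ cong (λ σ → not (any (_<ᵇ j) w) ∧ (not (hasOccurrence (m ∷ w)) ∧ not (hasOccurrence σ)))
            (++-assoc u [ x ] w) ⟩
  not (any (_<ᵇ j) w) ∧ (not (hasOccurrence (m ∷ w)) ∧ not (hasOccurrence (u ++ x ∷ w)))
    ≡⟨ cong (not (any (_<ᵇ j) w) ∧_)
            (absorb (startsOccurrence m w) (startsOccurrence x w) (hasOccurrence w)
                    (hasOccurrence (u ++ x ∷ w)) (hasOccurrence-++ʳ u (x ∷ w))) ⟩
  not (any (_<ᵇ j) w)
    ∧ (not (startsOccurrence m w ∨ hasOccurrence (x ∷ w)) ∧ not (hasOccurrence (u ++ x ∷ w))) ∎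
  where
  open ≡-Reasoning
  -- since hasOccurrence (x ∷ w) implies hasOccurrence (u ++ x ∷ w), it may be dropped next to it
  absorb : ∀ h a b z → (a ∨ b) ∨ z ≡ z → not (h ∨ b) ∧ not z ≡ not (h ∨ (a ∨ b)) ∧ not z
  absorb h a     b     true  _ = trans (∧-zeroʳ _) (sym (∧-zeroʳ _))
  absorb h false false false _ = refl

tailForm-avoids : ∀ j m w → j ≤ m → All (_≤ m) w →
  tailForm j m (not ∘ hasOccurrence) w ≡ not (any (_<ᵇ j) w) ∧ not (hasOccurrence (m ∷ w))
tailForm-avoids j m w j≤m w≤m =
  trans (tailForm-avoids-++ j m [] w j≤m [] w≤m)
        (cong (not (any (_<ᵇ j) w) ∧_) (drop-suffix (hasOccurrence w) (hasOccurrence (m ∷ w))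
                                                    (hasOccurrence-++ʳ [ m ] w)))
  where
  drop-suffix : ∀ a b → a ∨ b ≡ b → not b ∧ not a ≡ not b
  drop-suffix a     true  _ = refl
  drop-suffix false false _ = refl

avoidsWithMax : ℕ → List ℕ → Bool
avoidsWithMax m σ = avoids110-120 σ ∧ (maxL σ ≡ᵇ m)

avoidsWithMax-> : ∀ m σ → m < maxL σ → avoidsWithMax m σ ≡ false
avoidsWithMax-> m σ m<max rewrite ≡ᵇ-sym (maxL σ) m | <⇒≡ᵇ≡false m<max = ∧-zeroʳ _

avoidsWithMax-< : ∀ m σ → maxL σ < m → avoidsWithMax m σ ≡ false
avoidsWithMax-< m σ max<m rewrite <⇒≡ᵇ≡false max<m = ∧-zeroʳ _

avoids-firstMax : ∀ m s w → All (_< m) s → All (_≤ m) w →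
  avoidsWithMax m (s ++ m ∷ w) ≡ avoids110-120 s ∧ tailForm (maxL s) m (not ∘ hasOccurrence) w
avoids-firstMax m s w s<m w≤m = go (All.map <⇒≤ s<m)
  where
  go : All (_≤ m) s →
       avoidsWithMax m (s ++ m ∷ w) ≡ avoids110-120 s ∧ tailForm (maxL s) m (not ∘ hasOccurrence) w
  go s≤m
    rewrite maxL-++ s (m ∷ w) | m≥n⇒m⊔n≡m (maxL-≤ w w≤m) | m≤n⇒m⊔n≡n (maxL-≤ s s≤m) | ≡ᵇ-refl m
          | ∧-identityʳ (avoids110-120 (s ++ m ∷ w))
          | avoids110-120≡not-hasOccurrence (s ++ m ∷ w) | avoids110-120≡not-hasOccurrence s
          | hasOccurrence-++-∷ s w s≤m | tailForm-avoids (maxL s) m w (maxL-≤ s s≤m) w≤m =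
    trans (deMorgan₂ (hasOccurrence s) _)
          (cong (not (hasOccurrence s) ∧_) (deMorgan₂ (any (_<ᵇ maxL s) w) (hasOccurrence (m ∷ w))))

-- Counting the suffixes

𝟙-∧ : ∀ a b → 𝟙 (a ∧ b) ≡ 𝟙 a * 𝟙 b
𝟙-∧ true  b = sym (+-identityʳ (𝟙 b))
𝟙-∧ false b = refl

∑-words-suc : ∀ ℓ N (g : List ℕ → ℕ) →
  ∑ (words (suc ℓ) N) g ≡ ∑< N (λ x → ∑ (words ℓ N) (g ∘ (x ∷_)))
∑-words-suc ℓ N g = begin
  ∑ (concatMap (λ x → map (x ∷_) (words ℓ N)) (upTo N)) g  ≡⟨ ∑-concatMap _ (upTo N) g ⟩
  ∑ (upTo N) (λ x → ∑ (map (x ∷_) (words ℓ N)) g)          ≡⟨ ∑-upTo N _ ⟩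
  ∑< N (λ x → ∑ (map (x ∷_) (words ℓ N)) g)
    ≡⟨ ∑<-cong N (λ x → ∑-map (x ∷_) (words ℓ N) g) ⟩
  ∑< N (λ x → ∑ (words ℓ N) (g ∘ (x ∷_)))                  ∎
  where open ≡-Reasoning

∑-words-cong : ∀ ℓ N {f g : List ℕ → ℕ} → (∀ w → All (_< N) w → f w ≡ g w) →
  ∑ (words ℓ N) f ≡ ∑ (words ℓ N) g
∑-words-cong zero    N f≗g = cong (_+ 0) (f≗g [] [])
∑-words-cong (suc ℓ) N {f} {g} f≗g = begin
  ∑ (words (suc ℓ) N) f                    ≡⟨ ∑-words-suc ℓ N f ⟩
  ∑< N (λ x → ∑ (words ℓ N) (f ∘ (x ∷_)))
    ≡⟨ ∑<-cong< N (λ x x<N → ∑-words-cong ℓ N (λ w w<N → f≗g (x ∷ w) (x<N ∷ w<N))) ⟩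
  ∑< N (λ x → ∑ (words ℓ N) (g ∘ (x ∷_)))  ≡⟨ ∑-words-suc ℓ N g ⟨
  ∑ (words (suc ℓ) N) g                    ∎
  where open ≡-Reasoning

count-all-≡ᵇ : ∀ k m → ∑ (words k (suc m)) (𝟙 ∘ all (_≡ᵇ m)) ≡ 1
count-all-≡ᵇ zero    m = refl
count-all-≡ᵇ (suc k) m = begin
  ∑ (words (suc k) (suc m)) (𝟙 ∘ all (_≡ᵇ m))             ≡⟨ ∑-words-suc k (suc m) _ ⟩
  ∑< (suc m) (λ x → ∑ (words k (suc m)) (λ w → 𝟙 ((x ≡ᵇ m) ∧ all (_≡ᵇ m) w)))
    ≡⟨ ∑<-cong (suc m) only-m ⟩
  ∑< (suc m) (λ x → if x ≡ᵇ m then count else 0)         ≡⟨ ∑<-indicator (suc m) m (λ _ → count) ⟩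
  (if m <ᵇ suc m then count else 0)                      ≡⟨ cong (if_then count else 0) (<⇒<ᵇ≡true (n<1+n m)) ⟩
  count                                                  ≡⟨ count-all-≡ᵇ k m ⟩
  1                                                      ∎
  where
  open ≡-Reasoning
  count : ℕ
  count = ∑ (words k (suc m)) (𝟙 ∘ all (_≡ᵇ m))
  only-m : ∀ x → ∑ (words k (suc m)) (λ w → 𝟙 ((x ≡ᵇ m) ∧ all (_≡ᵇ m) w))
                 ≡ (if x ≡ᵇ m then count else 0)
  only-m x with x ≡ᵇ m
  ... | true  = refl
  ... | false = ∑-≡0 (λ _ → refl) (words k (suc m))

-- Splitting w as in tailForm: v is a word over [j, j + d), counted by its length ℓ ≤ k, and the
-- block of maximal entries that completes it to length k is unique.
count-tailForm : ∀ j d k (P : List ℕ → Bool) →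
  ∑ (words k (suc (j + d))) (𝟙 ∘ tailForm j (j + d) P)
    ≡ ∑< (suc k) (λ ℓ → ∑ (words ℓ d) (𝟙 ∘ P ∘ map (j +_)))
count-tailForm j d zero    P = sym (+-identityʳ _)
count-tailForm j d (suc k) P = begin
  ∑ (words (suc k) (suc N)) (𝟙 ∘ tailForm j N P)
    ≡⟨ ∑-words-suc k (suc N) _ ⟩
  ∑< (suc N) h
    ≡⟨ ∑<-suc N h ⟩
  ∑< (j + d) h + h N
    ≡⟨ cong (_+ h N) (∑<-+ j d h) ⟩
  (∑< j h + ∑< d (λ i → h (j + i))) + h N
    ≡⟨ cong₂ (λ a b → (a + b) + h N) (∑<-≡0 j below-j) (∑<-cong< d between) ⟩
  ∑< d (λ i → ∑< (suc k) (λ ℓ → f ℓ i)) + h N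
    ≡⟨ cong₂ _+_ (∑<-comm d (suc k) (λ i ℓ → f ℓ i)) at-N ⟩
  ∑< (suc k) (λ ℓ → ∑< d (f ℓ)) + 𝟙 (P [])
    ≡⟨ +-comm (∑< (suc k) (λ ℓ → ∑< d (f ℓ))) (𝟙 (P [])) ⟩
  𝟙 (P []) + ∑< (suc k) (λ ℓ → ∑< d (f ℓ))
    ≡⟨ cong₂ _+_ (sym (+-identityʳ (𝟙 (P []))))
             (∑<-cong (suc k) (λ ℓ → sym (∑-words-suc ℓ d (𝟙 ∘ P ∘ map (j +_))))) ⟩
  ∑< (suc (suc k)) (λ ℓ → ∑ (words ℓ d) (𝟙 ∘ P ∘ map (j +_)))
    ∎
  where
  open ≡-Reasoning
  N = j + d
  h : ℕ → ℕ
  h x = ∑ (words k (suc N)) (λ w → 𝟙 (tailForm j N P (x ∷ w)))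
  f : ℕ → ℕ → ℕ
  f ℓ i = ∑ (words ℓ d) (λ v → 𝟙 (P (j + i ∷ map (j +_) v)))
  below-j : ∀ x → x < j → h x ≡ 0
  below-j x x<j rewrite <⇒≡ᵇ≡false (<-≤-trans x<j (m≤m+n j d)) | <⇒<ᵇ≡true x<j =
    ∑-≡0 (λ _ → refl) (words k (suc N))
  between : ∀ i → i < d → h (j + i) ≡ ∑< (suc k) (λ ℓ → f ℓ i)
  between i i<d rewrite <⇒≡ᵇ≡false (+-monoʳ-< j i<d) | ≤⇒>ᵇ≡false (m≤m+n j i)
                      | <⇒<ᵇ≡true (+-monoʳ-< j i<d) = count-tailForm j d k (λ v → P (j + i ∷ v))
  at-N : h N ≡ 𝟙 (P [])
  at-N rewrite ≡ᵇ-refl N = begin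
    ∑ (words k (suc N)) (λ w → 𝟙 (all (_≡ᵇ N) w ∧ P []))
      ≡⟨ ∑-cong (λ w → 𝟙-∧ (all (_≡ᵇ N) w) (P [])) (words k (suc N)) ⟩
    ∑ (words k (suc N)) (λ w → 𝟙 (all (_≡ᵇ N) w) * 𝟙 (P []))
      ≡⟨ ∑-*ʳ (𝟙 (P [])) (words k (suc N)) (𝟙 ∘ all (_≡ᵇ N)) ⟩
    ∑ (words k (suc N)) (𝟙 ∘ all (_≡ᵇ N)) * 𝟙 (P [])    ≡⟨ cong (_* 𝟙 (P [])) (count-all-≡ᵇ k N) ⟩
    1 * 𝟙 (P [])                                        ≡⟨ *-identityˡ _ ⟩
    𝟙 (P [])                                            ∎

𝔟≡∑< : ∀ k d → 𝔟 k d ≡ ∑< (suc k) (λ ℓ → ∑ (words ℓ d) (𝟙 ∘ avoids110-120))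
𝔟≡∑< k d = trans (∑-upTo (suc k) (λ ℓ → length (filterᵇ avoids110-120 (words ℓ d))))
                 (∑<-cong (suc k) (λ ℓ → length-filterᵇ avoids110-120 (words ℓ d)))

count-tailForm-avoids : ∀ j m k → j ≤ m →
  ∑ (words k (suc m)) (𝟙 ∘ tailForm j m (not ∘ hasOccurrence)) ≡ 𝔟 k (m ∸ j)
count-tailForm-avoids j m k j≤m with m ∸ j | m+[n∸m]≡n j≤m
... | d | refl = begin
  ∑ (words k (suc (j + d))) (𝟙 ∘ tailForm j (j + d) (not ∘ hasOccurrence))
    ≡⟨ count-tailForm j d k (not ∘ hasOccurrence) ⟩
  ∑< (suc k) (λ ℓ → ∑ (words ℓ d) (𝟙 ∘ not ∘ hasOccurrence ∘ map (j +_)))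
    ≡⟨ ∑<-cong (suc k) (λ ℓ → ∑-cong unshift (words ℓ d)) ⟩
  ∑< (suc k) (λ ℓ → ∑ (words ℓ d) (𝟙 ∘ avoids110-120))
    ≡⟨ 𝔟≡∑< k d ⟨
  𝔟 k d ∎
  where
  open ≡-Reasoning
  unshift : ∀ v → 𝟙 (not (hasOccurrence (map (j +_) v))) ≡ 𝟙 (avoids110-120 v)
  unshift v = cong 𝟙 (trans (cong not (hasOccurrence-+ˡ j v)) (sym (avoids110-120≡not-hasOccurrence v)))

count-after-firstMax : ∀ m s k → All (_< m) s →
  ∑ (words k (suc m)) (λ w → 𝟙 (avoidsWithMax m (s ++ m ∷ w)))
    ≡ 𝟙 (avoids110-120 s) * 𝔟 k (m ∸ maxL s)
count-after-firstMax m s k s<m = begin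
  ∑ (words k (suc m)) (λ w → 𝟙 (avoidsWithMax m (s ++ m ∷ w)))
    ≡⟨ ∑-words-cong k (suc m) (λ w w<m → cong 𝟙 (avoids-firstMax m s w s<m (All.map ≤-pred w<m))) ⟩
  ∑ (words k (suc m)) (λ w → 𝟙 (avoids110-120 s ∧ tailForm (maxL s) m (not ∘ hasOccurrence) w))
    ≡⟨ ∑-cong (λ w → 𝟙-∧ (avoids110-120 s) _) (words k (suc m)) ⟩
  ∑ (words k (suc m)) (λ w → 𝟙 (avoids110-120 s) * 𝟙 (tailForm (maxL s) m (not ∘ hasOccurrence) w))
    ≡⟨ ∑-*ˡ (𝟙 (avoids110-120 s)) (words k (suc m)) _ ⟩
  𝟙 (avoids110-120 s) * ∑ (words k (suc m)) (𝟙 ∘ tailForm (maxL s) m (not ∘ hasOccurrence))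
    ≡⟨ cong (𝟙 (avoids110-120 s) *_) (count-tailForm-avoids (maxL s) m k (maxL-≤ s (All.map <⇒≤ s<m))) ⟩
  𝟙 (avoids110-120 s) * 𝔟 k (m ∸ maxL s) ∎
  where open ≡-Reasoning

-- Inversion sequences by the position of their first maximum

-- The possible continuations of length k of an inversion sequence of size q.
extensions : ℕ → ℕ → List (List ℕ)
extensions q zero    = [] ∷ []
extensions q (suc k) = concatMap (λ x → map (x ∷_) (extensions (suc q) k)) (upTo (suc q))

∑-extensions-suc : ∀ q k (g : List ℕ → ℕ) →
  ∑ (extensions q (suc k)) g ≡ ∑< (suc q) (λ x → ∑ (extensions (suc q) k) (g ∘ (x ∷_)))
∑-extensions-suc q k g = begin
  ∑ (concatMap (λ x → map (x ∷_) (extensions (suc q) k)) (upTo (suc q))) g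
    ≡⟨ ∑-concatMap (λ x → map (x ∷_) (extensions (suc q) k)) (upTo (suc q)) g ⟩
  ∑ (upTo (suc q)) (λ x → ∑ (map (x ∷_) (extensions (suc q) k)) g)
    ≡⟨ ∑-upTo (suc q) _ ⟩
  ∑< (suc q) (λ x → ∑ (map (x ∷_) (extensions (suc q) k)) g)
    ≡⟨ ∑<-cong (suc q) (λ x → ∑-map (x ∷_) (extensions (suc q) k) g) ⟩
  ∑< (suc q) (λ x → ∑ (extensions (suc q) k) (g ∘ (x ∷_))) ∎
  where open ≡-Reasoning

∑-invSeqs-+ : ∀ q k (f : List ℕ → ℕ) →
  ∑ (invSeqs (q + k)) f ≡ ∑ (invSeqs q) (λ s → ∑ (extensions q k) (λ t → f (s ++ t)))
∑-invSeqs-+ q zero f rewrite +-identityʳ q =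
  ∑-cong (λ s → trans (cong f (sym (++-identityʳ s))) (sym (+-identityʳ _))) (invSeqs q)
∑-invSeqs-+ q (suc k) f rewrite +-suc q k = begin
  ∑ (invSeqs (suc q + k)) f
    ≡⟨ ∑-invSeqs-+ (suc q) k f ⟩
  ∑ (invSeqs (suc q)) g
    ≡⟨ ∑-concatMap (λ s → map (λ x → s ++ [ x ]) (upTo (suc q))) (invSeqs q) g ⟩
  ∑ (invSeqs q) (λ s → ∑ (map (λ x → s ++ [ x ]) (upTo (suc q))) g)
    ≡⟨ ∑-cong (λ s → trans (∑-map (λ x → s ++ [ x ]) (upTo (suc q)) g) (∑-upTo (suc q) _)) (invSeqs q) ⟩
  ∑ (invSeqs q) (λ s → ∑< (suc q) (λ x → g (s ++ [ x ])))
    ≡⟨ ∑-cong (λ s → ∑<-cong (suc q) (λ x →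
         ∑-cong (λ t → cong f (++-assoc s [ x ] t)) (extensions (suc q) k))) (invSeqs q) ⟩
  ∑ (invSeqs q) (λ s → ∑< (suc q) (λ x → ∑ (extensions (suc q) k) (λ t → f (s ++ x ∷ t))))
    ≡⟨ ∑-cong (λ s → ∑-extensions-suc q k (λ t → f (s ++ t))) (invSeqs q) ⟨
  ∑ (invSeqs q) (λ s → ∑ (extensions q (suc k)) (λ t → f (s ++ t))) ∎
  where
  open ≡-Reasoning
  g : List ℕ → ℕ
  g s = ∑ (extensions (suc q) k) (λ t → f (s ++ t))

-- Once r ≥ m, the constraints of an extension are void for lists with entries ≤ m.
∑-extensions-≤ : ∀ m k r (f : List ℕ → ℕ) → m ≤ r → (∀ t → ¬ All (_≤ m) t → f t ≡ 0) →
  ∑ (extensions r k) f ≡ ∑ (words k (suc m)) f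
∑-extensions-≤ m zero    r f m≤r f≗0 = refl
∑-extensions-≤ m (suc k) r f m≤r f≗0 = begin
  ∑ (extensions r (suc k)) f
    ≡⟨ ∑-extensions-suc r k f ⟩
  ∑< (suc r) h
    ≡⟨ cong (λ n → ∑< n h) (sym (cong suc (m+[n∸m]≡n m≤r))) ⟩
  ∑< (suc m + (r ∸ m)) h
    ≡⟨ ∑<-+ (suc m) (r ∸ m) h ⟩
  ∑< (suc m) h + ∑< (r ∸ m) (λ i → h (suc m + i))
    ≡⟨ cong₂ _+_ (∑<-cong (suc m) small)
                 (∑<-≡0 (r ∸ m) (λ i _ → large (suc m + i) (s≤s (m≤m+n m i)))) ⟩
  ∑< (suc m) (λ x → ∑ (words k (suc m)) (f ∘ (x ∷_))) + 0
    ≡⟨ +-identityʳ _ ⟩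
  ∑< (suc m) (λ x → ∑ (words k (suc m)) (f ∘ (x ∷_)))
    ≡⟨ ∑-words-suc k (suc m) f ⟨
  ∑ (words (suc k) (suc m)) f ∎
  where
  open ≡-Reasoning
  h : ℕ → ℕ
  h x = ∑ (extensions (suc r) k) (f ∘ (x ∷_))
  small : ∀ x → h x ≡ ∑ (words k (suc m)) (f ∘ (x ∷_))
  small x = ∑-extensions-≤ m k (suc r) (f ∘ (x ∷_)) (m≤n⇒m≤1+n m≤r)
              (λ t t≰m → f≗0 (x ∷ t) (λ { (_ ∷ t≤m) → t≰m t≤m }))
  large : ∀ x → m < x → h x ≡ 0
  large x m<x = ∑-≡0 (λ t → f≗0 (x ∷ t) (λ { (x≤m ∷ _) → <⇒≱ m<x x≤m })) (extensions (suc r) k)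

-- firstMaxTerm m k q s i counts the extensions t of length k of s (an inversion sequence of size q
-- with entries < m) such that s ++ t avoids 110 and 120, has maximum m, and has its first m at
-- position i of t; that position is q + i + 1, so it needs m < q + i + 1.
firstMaxTerm : ℕ → ℕ → ℕ → List ℕ → ℕ → ℕ
firstMaxTerm m k q s i =
  𝟙 (m <ᵇ suc (q + i)) *
  ∑ (extensions q i) (λ t → 𝟙 (all (_<ᵇ m) t ∧ avoids110-120 (s ++ t)) * 𝔟 (k ∸ suc i) (m ∸ maxL (s ++ t)))

firstMaxTerm-zero : ∀ m k q s → All (_< m) s →
  firstMaxTerm m (suc k) q s 0
    ≡ (if m <ᵇ suc q then ∑ (extensions (suc q) k) (λ t → 𝟙 (avoidsWithMax m (s ++ m ∷ t))) else 0)
firstMaxTerm-zero m k q s s<m rewrite +-identityʳ q | ++-identityʳ s with m <ᵇ suc q in m<ᵇ1+q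
... | false = refl
... | true  = begin
  𝟙 (avoids110-120 s) * 𝔟 k (m ∸ maxL s) + 0 + 0
    ≡⟨ trans (+-identityʳ _) (+-identityʳ _) ⟩
  𝟙 (avoids110-120 s) * 𝔟 k (m ∸ maxL s)
    ≡⟨ count-after-firstMax m s k s<m ⟨
  ∑ (words k (suc m)) (λ t → 𝟙 (avoidsWithMax m (s ++ m ∷ t)))
    ≡⟨ ∑-extensions-≤ m k (suc q) _ (<⇒≤ (<ᵇ≡true⇒< m<ᵇ1+q)) above-m ⟨
  ∑ (extensions (suc q) k) (λ t → 𝟙 (avoidsWithMax m (s ++ m ∷ t))) ∎
  where
  open ≡-Reasoning
  above-m : ∀ t → ¬ All (_≤ m) t → 𝟙 (avoidsWithMax m (s ++ m ∷ t)) ≡ 0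
  above-m t t≰m = cong 𝟙 (avoidsWithMax-> m (s ++ m ∷ t)
    (<-≤-trans (≰⇒> (t≰m ∘ maxL-≤⇒All t)) (≤-trans (m≤n⊔m m (maxL t)) (⊔-maxL-≤ s m t))))

firstMaxTerm-suc : ∀ m k q s →
  ∑< k (λ i → firstMaxTerm m (suc k) q s (suc i))
    ≡ ∑< (suc q) (λ x → if x <ᵇ m then ∑< k (firstMaxTerm m k (suc q) (s ++ [ x ])) else 0)
firstMaxTerm-suc m k q s = begin
  ∑< k (λ i → c i * ∑ (extensions q (suc i)) (F i))
    ≡⟨ ∑<-cong k (λ i → cong (c i *_) (∑-extensions-suc q i (F i))) ⟩
  ∑< k (λ i → c i * ∑< (suc q) (λ x → ∑ (extensions (suc q) i) (F i ∘ (x ∷_))))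
    ≡⟨ ∑<-cong k (λ i → ∑<-*ˡ (c i) (suc q) (λ x → ∑ (extensions (suc q) i) (F i ∘ (x ∷_)))) ⟨
  ∑< k (λ i → ∑< (suc q) (λ x → c i * ∑ (extensions (suc q) i) (F i ∘ (x ∷_))))
    ≡⟨ ∑<-comm k (suc q) (λ i x → c i * ∑ (extensions (suc q) i) (F i ∘ (x ∷_))) ⟩
  ∑< (suc q) (λ x → ∑< k (λ i → c i * ∑ (extensions (suc q) i) (F i ∘ (x ∷_))))
    ≡⟨ ∑<-cong (suc q) first-entry ⟩
  ∑< (suc q) (λ x → if x <ᵇ m then ∑< k (firstMaxTerm m k (suc q) (s ++ [ x ])) else 0) ∎
  where
  open ≡-Reasoning
  c : ℕ → ℕ
  c i = 𝟙 (m <ᵇ suc (q + suc i))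
  F : ℕ → List ℕ → ℕ
  F i t = 𝟙 (all (_<ᵇ m) t ∧ avoids110-120 (s ++ t)) * 𝔟 (k ∸ suc i) (m ∸ maxL (s ++ t))
  first-entry : ∀ x → ∑< k (λ i → c i * ∑ (extensions (suc q) i) (F i ∘ (x ∷_)))
                      ≡ (if x <ᵇ m then ∑< k (firstMaxTerm m k (suc q) (s ++ [ x ])) else 0)
  first-entry x with x <ᵇ m
  ... | false = ∑<-≡0 k (λ i _ →
                  trans (cong (c i *_) (∑-≡0 (λ _ → refl) (extensions (suc q) i))) (*-zeroʳ (c i)))
  ... | true  = ∑<-cong k (λ i → cong₂ _*_ (cong (λ n → 𝟙 (m <ᵇ suc n)) (+-suc q i))
                  (∑-cong (λ t → cong (λ σ → 𝟙 (all (_<ᵇ m) t ∧ avoids110-120 σ) * 𝔟 (k ∸ suc i) (m ∸ maxL σ))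
                                      (sym (++-assoc s [ x ] t)))
                          (extensions (suc q) i)))

split-<-≡ : ∀ m (g : ℕ → ℕ) → (∀ x → m < x → g x ≡ 0) →
  ∀ x → g x ≡ (if x <ᵇ m then g x else 0) + (if x ≡ᵇ m then g x else 0)
split-<-≡ m g g>m≡0 x with <-cmp x m
... | tri< x<m _ _    rewrite <⇒<ᵇ≡true x<m | <⇒≡ᵇ≡false x<m = sym (+-identityʳ _)
... | tri≈ _ refl _   rewrite <ᵇ-irrefl x | ≡ᵇ-refl x = refl
... | tri> _ _ m<x    rewrite ≤⇒>ᵇ≡false (<⇒≤ m<x) | ≡ᵇ-sym x m | <⇒≡ᵇ≡false m<x = g>m≡0 x m<x

count-by-firstMax : ∀ m k q s → 0 < m → All (_< m) s →
  ∑ (extensions q k) (λ t → 𝟙 (avoidsWithMax m (s ++ t))) ≡ ∑< k (firstMaxTerm m k q s)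
count-by-firstMax m zero    q s 0<m s<m rewrite ++-identityʳ s | avoidsWithMax-< m s (maxL-< s 0<m s<m) = refl
count-by-firstMax m (suc k) q s 0<m s<m = begin
  ∑ (extensions q (suc k)) (λ t → 𝟙 (avoidsWithMax m (s ++ t)))
    ≡⟨ ∑-extensions-suc q k (λ t → 𝟙 (avoidsWithMax m (s ++ t))) ⟩
  ∑< (suc q) g
    ≡⟨ ∑<-cong (suc q) (split-<-≡ m g above-m) ⟩
  ∑< (suc q) (λ x → (if x <ᵇ m then g x else 0) + (if x ≡ᵇ m then g x else 0))
    ≡⟨ ∑<-distrib-+ (suc q) (λ x → if x <ᵇ m then g x else 0) (λ x → if x ≡ᵇ m then g x else 0) ⟩
  ∑< (suc q) (λ x → if x <ᵇ m then g x else 0) + ∑< (suc q) (λ x → if x ≡ᵇ m then g x else 0)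
    ≡⟨ cong₂ _+_ (∑<-cong (suc q) below-m) (∑<-indicator (suc q) m g) ⟩
  ∑< (suc q) (λ x → if x <ᵇ m then ∑< k (firstMaxTerm m k (suc q) (s ++ [ x ])) else 0)
    + (if m <ᵇ suc q then g m else 0)
    ≡⟨ cong₂ _+_ (firstMaxTerm-suc m k q s) (firstMaxTerm-zero m k q s s<m) ⟨
  ∑< k (λ i → firstMaxTerm m (suc k) q s (suc i)) + firstMaxTerm m (suc k) q s 0
    ≡⟨ +-comm _ (firstMaxTerm m (suc k) q s 0) ⟩
  ∑< (suc k) (firstMaxTerm m (suc k) q s) ∎
  where
  open ≡-Reasoning
  g : ℕ → ℕ
  g x = ∑ (extensions (suc q) k) (λ t → 𝟙 (avoidsWithMax m (s ++ x ∷ t)))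
  above-m : ∀ x → m < x → g x ≡ 0
  above-m x m<x = ∑-≡0 (λ t → cong 𝟙 (avoidsWithMax-> m (s ++ x ∷ t)
                    (<-≤-trans m<x (≤-trans (m≤m⊔n x (maxL t)) (⊔-maxL-≤ s x t))))) (extensions (suc q) k)
  below-m : ∀ x → (if x <ᵇ m then g x else 0)
                  ≡ (if x <ᵇ m then ∑< k (firstMaxTerm m k (suc q) (s ++ [ x ])) else 0)
  below-m x with x <ᵇ m in x<ᵇm
  ... | false = refl
  ... | true  = trans (∑-cong (λ t → cong (𝟙 ∘ avoidsWithMax m) (sym (++-assoc s [ x ] t))) (extensions (suc q) k))
                      (count-by-firstMax m k (suc q) (s ++ [ x ]) 0<m (++⁺ s<m (<ᵇ≡true⇒< x<ᵇm ∷ [])))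

∑-invSeqs : ∀ p (f : List ℕ → ℕ) → ∑ (invSeqs p) f ≡ ∑ (extensions 0 p) f
∑-invSeqs p f = trans (∑-invSeqs-+ 0 p f) (+-identityʳ _)

𝔞≡∑-extensions : ∀ p j → 𝔞 p j ≡ ∑ (extensions 0 p) (𝟙 ∘ avoidsWithMax j)
𝔞≡∑-extensions p j =
  trans (length-filterᵇ-filterᵇ avoids110-120 (λ σ → maxL σ ≡ᵇ j) (invSeqs p)) (∑-invSeqs p _)

∑<-𝔞 : ∀ p m (c : ℕ → ℕ) →
  ∑< (suc m) (λ j → 𝔞 p j * c j)
    ≡ ∑ (extensions 0 p) (λ t → 𝟙 (all (_<ᵇ suc m) t ∧ avoids110-120 t) * c (maxL t))
∑<-𝔞 p m c = begin
  ∑< (suc m) (λ j → 𝔞 p j * c j)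
    ≡⟨ ∑<-cong (suc m) (λ j → trans (cong (_* c j) (𝔞≡∑-extensions p j))
                                    (sym (∑-*ʳ (c j) (extensions 0 p) _))) ⟩
  ∑< (suc m) (λ j → ∑ (extensions 0 p) (λ t → 𝟙 (avoidsWithMax j t) * c j))
    ≡⟨ ∑<-∑ (suc m) (extensions 0 p) (λ j t → 𝟙 (avoidsWithMax j t) * c j) ⟩
  ∑ (extensions 0 p) (λ t → ∑< (suc m) (λ j → 𝟙 (avoidsWithMax j t) * c j))
    ≡⟨ ∑-cong only-max (extensions 0 p) ⟩
  ∑ (extensions 0 p) (λ t → 𝟙 (all (_<ᵇ suc m) t ∧ avoids110-120 t) * c (maxL t)) ∎
  where
  open ≡-Reasoning
  at-max : ∀ t j → 𝟙 (avoidsWithMax j t) * c j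
                   ≡ (if j ≡ᵇ maxL t then 𝟙 (avoids110-120 t) * c j else 0)
  at-max t j rewrite ≡ᵇ-sym (maxL t) j with j ≡ᵇ maxL t
  ... | true  rewrite ∧-identityʳ (avoids110-120 t) = refl
  ... | false rewrite ∧-zeroʳ (avoids110-120 t) = refl
  only-max : ∀ t → ∑< (suc m) (λ j → 𝟙 (avoidsWithMax j t) * c j)
                   ≡ 𝟙 (all (_<ᵇ suc m) t ∧ avoids110-120 t) * c (maxL t)
  only-max t rewrite all-<ᵇ≡maxL-<ᵇ m t
    = trans (∑<-cong (suc m) (at-max t))
            (trans (∑<-indicator (suc m) (maxL t) (λ j → 𝟙 (avoids110-120 t) * c j))
                   (if-𝟙 (maxL t <ᵇ suc m)))
    where
    if-𝟙 : ∀ b → (if b then 𝟙 (avoids110-120 t) * c (maxL t) else 0)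
                 ≡ 𝟙 (b ∧ avoids110-120 t) * c (maxL t)
    if-𝟙 true  = refl
    if-𝟙 false = refl

firstMaxTerm-[] : ∀ m k i → 0 < m → m ≤ i →
  firstMaxTerm m k 0 [] i ≡ Σ[ 0 ⋯ m ∸ 1 ] (λ j → 𝔞 i j * 𝔟 (k ∸ suc i) (m ∸ j))
firstMaxTerm-[] (suc m) k i _ m<1+i rewrite <⇒<ᵇ≡true (s≤s m<1+i) = begin
  1 * ∑ (extensions 0 i) (λ t → 𝟙 (all (_<ᵇ suc m) t ∧ avoids110-120 t) * 𝔟 (k ∸ suc i) (suc m ∸ maxL t))
    ≡⟨ *-identityˡ _ ⟩
  ∑ (extensions 0 i) (λ t → 𝟙 (all (_<ᵇ suc m) t ∧ avoids110-120 t) * 𝔟 (k ∸ suc i) (suc m ∸ maxL t))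
    ≡⟨ ∑<-𝔞 i m (λ j → 𝔟 (k ∸ suc i) (suc m ∸ j)) ⟨
  ∑< (suc m) (λ j → 𝔞 i j * 𝔟 (k ∸ suc i) (suc m ∸ j))
    ≡⟨ ∑-upTo (suc m) _ ⟨
  Σ[ 0 ⋯ m ] (λ j → 𝔞 i j * 𝔟 (k ∸ suc i) (suc m ∸ j)) ∎
  where open ≡-Reasoning

𝔞-by-firstMax : ∀ m n → 0 < m → m ≤ n → 𝔞 n m ≡ ∑< (n ∸ m) (λ i → firstMaxTerm m n 0 [] (m + i))
𝔞-by-firstMax m n 0<m m≤n = begin
  𝔞 n m
    ≡⟨ 𝔞≡∑-extensions n m ⟩
  ∑ (extensions 0 n) (𝟙 ∘ avoidsWithMax m)
    ≡⟨ count-by-firstMax m n 0 [] 0<m [] ⟩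
  ∑< n (firstMaxTerm m n 0 [])
    ≡⟨ cong (λ k → ∑< k (firstMaxTerm m n 0 [])) (m+[n∸m]≡n m≤n) ⟨
  ∑< (m + (n ∸ m)) (firstMaxTerm m n 0 [])
    ≡⟨ ∑<-+ m (n ∸ m) (firstMaxTerm m n 0 []) ⟩
  ∑< m (firstMaxTerm m n 0 []) + ∑< (n ∸ m) (λ i → firstMaxTerm m n 0 [] (m + i))
    ≡⟨ cong (_+ ∑< (n ∸ m) (λ i → firstMaxTerm m n 0 [] (m + i))) (∑<-≡0 m too-early) ⟩
  ∑< (n ∸ m) (λ i → firstMaxTerm m n 0 [] (m + i)) ∎
  where
  open ≡-Reasoning
  too-early : ∀ i → i < m → firstMaxTerm m n 0 [] i ≡ 0
  too-early i i<m rewrite ≤⇒>ᵇ≡false i<m = refl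

theorem14 : (n m : ℕ) → 0 < m → m < n →
    𝔞 n m ≡ Σ[ suc m ⋯ n ] (λ p → Σ[ 0 ⋯ m ∸ 1 ] (λ j → 𝔞 (p ∸ 1) j * 𝔟 (n ∸ p) (m ∸ j)))
theorem14 n m 0<m m<n = begin
  𝔞 n m
    ≡⟨ 𝔞-by-firstMax m n 0<m (<⇒≤ m<n) ⟩
  ∑< (n ∸ m) (λ i → firstMaxTerm m n 0 [] (m + i))
    ≡⟨ ∑<-cong (n ∸ m) (λ i → firstMaxTerm-[] m n (m + i) 0<m (m≤m+n m i)) ⟩
  ∑< (n ∸ m) (λ i → Σ[ 0 ⋯ m ∸ 1 ] (λ j → 𝔞 (m + i) j * 𝔟 (n ∸ suc (m + i)) (m ∸ j)))
    ≡⟨ ∑-upTo (n ∸ m) _ ⟨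
  Σ[ suc m ⋯ n ] (λ p → Σ[ 0 ⋯ m ∸ 1 ] (λ j → 𝔞 (p ∸ 1) j * 𝔟 (n ∸ p) (m ∸ j))) ∎
  where open ≡-Reasoning
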